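{- Let $p\equiv5\pmod8$ and $q\equiv 1\pmod 8$ be primes with $\left(\frac{2}{q}\right)_4\neq(-1)^{\frac{q-1}{8}}$, $D=pq$. (i) If $N(\varepsilon_D)=-1$, then the prime ideal of $\mathbb{Q}(\sqrt D)$ above $q$ is not principal. (ii) If $N(\varepsilon_{2D})=-1$, then the prime ideal of $\mathbb{Q}(\sqrt{2D})$ above $q$ is not principal.
   Context: $\varepsilon_D$, $\varepsilon_{2D}$ denote the fundamental units of $\mathbb{Q}(\sqrt D)$ and $\mathbb{Q}(\sqrt{2D})$, and $N$ denotes the norm from the respective field to $\mathbb{Q}$. $\left(\frac{2}{q}\right)_4$ is the rational quartic residue symbol. -}

module Defs where

open import Data.Nat as ℕ using (ℕ)
open import Data.Integer using (ℤ; +_; -_; _+_; _-_; _*_; _^_; _≤_; _<_)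
open import Data.Integer.Divisibility using (_∣_)
open import Data.Product using (Σ; _×_; _,_)
open import Data.Sum using (_⊎_)
open import Relation.Nullary using (¬_)
open import Relation.Binary.PropositionalEquality using (_≡_; _≢_)

-- A pair (a , b) : ℤ × ℤ represents the number (a + b√d)/2.
-- Such a number is an algebraic integer iff its trace a and its norm
-- (a² - d b²)/4 are integers, i.e. iff 4 ∣ a² - d b².  So the ring of
-- integers O_d is exactly the set of pairs satisfying IsInt d.

Elem : Set
Elem = ℤ × ℤ

IsInt : ℤ → Elem → Set
IsInt d (a , b) = (+ 4) ∣ (a * a - d * b * b)

one : Elem
one = (+ 2 , + 0)

zeroE : Elem
zeroE = (+ 0 , + 0)

_⊕_ : Elem → Elem → Elem
(a , b) ⊕ (c , e) = (a + c , b + e)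

-- MulIs d α γ δ : α · γ = δ in Q(√d).
-- ((a + b√d)/2)((c + e√d)/2) = ((ac + dbe) + (ae + bc)√d)/4.
MulIs : ℤ → Elem → Elem → Elem → Set
MulIs d (a , b) (c , e) (x , y) =
  (a * c + d * b * e ≡ + 2 * x) × (a * e + b * c ≡ + 2 * y)

Divides : ℤ → Elem → Elem → Set
Divides d α β = Σ Elem (λ γ → IsInt d γ × MulIs d α γ β)

IsUnit : ℤ → Elem → Set
IsUnit d α = IsInt d α × Divides d α one

NormIs : ℤ → Elem → ℤ → Set
NormIs d (a , b) n = a * a - d * b * b ≡ + 4 * n

-- Real order (via the embedding √d > 0, d > 0 not a square):
-- Pos d x y  means  x + y√d > 0.
Pos : ℤ → ℤ → ℤ → Set
Pos d x y =
    (+ 0 ≤ x × + 0 ≤ y × (+ 0 < x ⊎ + 0 < y))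
  ⊎ (+ 0 ≤ x × y < + 0 × d * y * y < x * x)
  ⊎ (x < + 0 × + 0 ≤ y × x * x < d * y * y)

Gt : ℤ → Elem → Elem → Set
Gt d (a , b) (c , e) = Pos d (a - c) (b - e)

Ge : ℤ → Elem → Elem → Set
Ge d α β = Gt d α β ⊎ α ≡ β

IsFundamentalUnit : ℤ → Elem → Set
IsFundamentalUnit d ε =
  IsUnit d ε × Gt d ε one ×
  ((u : Elem) → IsUnit d u → Gt d u one → Ge d u ε)

record IsIdeal (d : ℤ) (P : Elem → Set) : Set where
  field
    ⊆O     : ∀ α → P α → IsInt d α
    has0   : P zeroE
    +-cl   : ∀ α β → P α → P β → P (α ⊕ β)
    *-cl   : ∀ α γ δ → P α → IsInt d γ → MulIs d α γ δ → P δ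

record IsPrimeIdeal (d : ℤ) (P : Elem → Set) : Set where
  field
    ideal  : IsIdeal d P
    proper : ¬ P one
    prime  : ∀ α β δ → IsInt d α → IsInt d β → MulIs d α β δ →
             P δ → P α ⊎ P β

-- P lies above the rational prime q: q ∈ P  (q is represented by (2q , 0))
LiesAbove : ℕ → (Elem → Set) → Set
LiesAbove q P = P (+ (2 ℕ.* q) , + 0)

IsPrincipal : ℤ → (Elem → Set) → Set
IsPrincipal d P =
  Σ Elem (λ α → IsInt d α ×
    ((β : Elem) → IsInt d β → (P β → Divides d α β) × (Divides d α β → P β)))

-- Rational quartic residue symbol (a/q)_4 for a prime q ≡ 1 (mod 8)
-- and a a quadratic residue mod q: it is 1 if a is a fourth power
-- modulo q, and -1 otherwise.

IsFourthPowerMod : ℕ → ℤ → Set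
IsFourthPowerMod q a = Σ ℤ (λ x → (+ q) ∣ (x ^ 4 - a))

QuarticSymbol : ℕ → ℤ → ℤ → Set
QuarticSymbol q a s =
  (s ≡ + 1 × IsFourthPowerMod q a) ⊎ (s ≡ - (+ 1) × ¬ IsFourthPowerMod q a)

-- Write d = r q.  If the prime P above q were principal, P = α O_d, then N(α) divides both
-- N(q) = q² and N(√d) = -d (since (√d)² = d ∈ P), and N(α) ≠ ±1 as P ≠ O_d; so N(α) = ±q.
-- Then q ∣ Tr(α), and α = (q a + b√d)/2 gives q a² - r b² = ±4.  For such a solution,
-- θ = (a√q + b√r)/2 squares to a unit η = (x + y√d)/2 > 1 of norm 1 with y = a b.  If the
-- fundamental unit ε has norm -1, then θ/ε is again of this shape, solving q a² - r b² = ∓4,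
-- and its η is η/ε², whose √d-coordinate lies in [0, a b) by the minimality of ε.  Infinite
-- descent on a b rules out every solution.

module Submission where

open import Defs
open import Data.Empty using (⊥-elim)
open import Data.Integer as ℤ using (ℤ; +_; 1ℤ; -1ℤ; _≤_)
open import Data.Integer.Properties using (pos-*)
import Data.Nat as ℕ
import Data.Nat.Divisibility as ℕ
open import Data.Nat.DivMod using (m%n≤m)
open import Data.Nat.Primality using (Prime; ¬prime[1]; prime[2]; prime⇒irreducible; euclidsLemma)
open import Data.Product using (Σ; _×_; _,_)
open import Data.Sum using (_⊎_; inj₁; inj₂; [_,_]′)
open import Function using (id; _∘_)
open import Relation.Binary.PropositionalEquality using (_≡_; _≢_; refl; subst; sym; cong; trans)
open import Relation.Nullary using (¬_; contradiction)

IsSign : ℤ → Set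
IsSign σ = σ ≡ 1ℤ ⊎ σ ≡ -1ℤ

module IntegerFacts where
  open import Data.Integer
  open import Data.Integer.Properties
  open import Data.Integer.Tactic.RingSolver using (solve-∀)
  open import Data.Integer.Divisibility using (_∣_)
  import Data.Integer.Divisibility.Signed as Signed
  import Data.Nat.Properties as ℕ
  open import Relation.Binary.PropositionalEquality using (module ≡-Reasoning)
  open import Relation.Nullary using (yes; no)
  open import Relation.Nullary.Decidable using (toWitness)

  sign-square : ∀ {σ} → IsSign σ → σ * σ ≡ 1ℤ
  sign-square (inj₁ refl) = refl
  sign-square (inj₂ refl) = refl

  sign-neg : ∀ {σ} → IsSign σ → IsSign (- σ)
  sign-neg (inj₁ refl) = inj₂ refl
  sign-neg (inj₂ refl) = inj₁ refl

  -- Identities that hold only modulo hypotheses A ≡ B: the ring solver checks L = M + k (A - B).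
  ≡-modulo₁ : ∀ {A B L M} → A ≡ B → ∀ k → L ≡ M + k * (A - B) → L ≡ M
  ≡-modulo₁ {A} {L = L} {M} refl k eq = begin
    L                ≡⟨ eq ⟩
    M + k * (A - A)  ≡⟨ cong (λ t → M + k * t) (+-inverseʳ A) ⟩
    M + k * 0ℤ       ≡⟨ cong (λ t → M + t) (*-zeroʳ k) ⟩
    M + 0ℤ           ≡⟨ +-identityʳ M ⟩
    M                ∎
    where open ≡-Reasoning

  ≡-modulo₂ : ∀ {A B A′ B′ L M} → A ≡ B → A′ ≡ B′ → ∀ k k′ →
              L ≡ M + k * (A - B) + k′ * (A′ - B′) → L ≡ M
  ≡-modulo₂ A≡B A′≡B′ k k′ eq = ≡-modulo₁ A≡B k (≡-modulo₁ A′≡B′ k′ eq)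

  0≤i*j : ∀ {i j} → 0ℤ ≤ i → 0ℤ ≤ j → 0ℤ ≤ i * j
  0≤i*j {+ m} {+ n} _ _ = subst (0ℤ ≤_) (pos-* m n) (+≤+ ℕ.z≤n)

  0<i*j : ∀ {i j} → 0ℤ < i → 0ℤ < j → 0ℤ < i * j
  0<i*j {+[1+ m ]} {+[1+ n ]} _ _      = +<+ (ℕ.s≤s ℕ.z≤n)
  0<i*j {+[1+ m ]} {+ ℕ.zero} _ (+<+ ())
  0<i*j {+ ℕ.zero} (+<+ ())

  0≤i*i : ∀ i → 0ℤ ≤ i * i
  0≤i*i (+ n)    = 0≤i*j {+ n} {+ n} (+≤+ ℕ.z≤n) (+≤+ ℕ.z≤n)
  0≤i*i -[1+ n ] = +≤+ ℕ.z≤n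

  0<i*i : ∀ {i} → i ≢ 0ℤ → 0ℤ < i * i
  0<i*i {+ ℕ.zero}   i≢0 = contradiction refl i≢0
  0<i*i {+[1+ n ]}  _   = +<+ (ℕ.s≤s ℕ.z≤n)
  0<i*i { -[1+ n ]} _   = +<+ (ℕ.s≤s ℕ.z≤n)

  ≤-*-square : ∀ {i j} → 0ℤ ≤ i → j ≢ 0ℤ → i ≤ i * j * j
  ≤-*-square {i} {j} 0≤i j≢0 = begin
    i           ≡⟨ sym (*-identityʳ i) ⟩
    i * 1ℤ      ≤⟨ *-monoˡ-≤-nonNeg i {{nonNegative 0≤i}} (i<j⇒suc[i]≤j (0<i*i j≢0)) ⟩
    i * (j * j) ≡⟨ sym (*-assoc i j j) ⟩
    i * j * j   ∎
    where open ≤-Reasoning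

  square-mono-≤ : ∀ {i j} → 0ℤ ≤ i → i ≤ j → i * i ≤ j * j
  square-mono-≤ {+ m} {+ n} _ (+≤+ m≤n)
    rewrite sym (pos-* m m) | sym (pos-* n n) = +≤+ (ℕ.*-mono-≤ m≤n m≤n)

  square-mono-< : ∀ {i j} → 0ℤ ≤ i → i < j → i * i < j * j
  square-mono-< {+ m} {+ n} _ (+<+ m<n)
    rewrite sym (pos-* m m) | sym (pos-* n n) = +<+ (ℕ.*-mono-< m<n m<n)

  0<j-i⇒i<j : ∀ {i j} → 0ℤ < j - i → i < j
  0<j-i⇒i<j 0<j-i = ≰⇒> (λ j≤i → <⇒≱ 0<j-i (i≤j⇒i-j≤0 j≤i))

  i<j⇒0<j-i : ∀ {i j} → i < j → 0ℤ < j - i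
  i<j⇒0<j-i i<j = ≰⇒> (λ j-i≤0 → <⇒≱ i<j (i-j≤0⇒i≤j j-i≤0))

  i-j<0⇒i<j : ∀ {i j} → i - j < 0ℤ → i < j
  i-j<0⇒i<j i-j<0 = ≰⇒> (λ j≤i → <⇒≱ i-j<0 (i≤j⇒0≤j-i j≤i))

  <-from-squares : ∀ {i j k} → 0ℤ ≤ j → j * j - i * i ≡ k → 0ℤ < k → i < j
  <-from-squares 0≤j refl 0<k =
    ≰⇒> (λ j≤i → <⇒≱ (0<j-i⇒i<j 0<k) (square-mono-≤ 0≤j j≤i))

  ≤-from-squares : ∀ {i j k} → 0ℤ ≤ j → j * j - i * i ≡ k → 0ℤ ≤ k → i ≤ j
  ≤-from-squares 0≤j refl 0≤k =
    ≮⇒≥ (λ j<i → <⇒≱ (square-mono-< 0≤j j<i) (0≤i-j⇒j≤i 0≤k))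

  5≤P⇒P*c*c≢4σ : ∀ {P c σ} → + 5 ≤ P → IsSign σ → P * c * c ≢ + 4 * σ
  5≤P⇒P*c*c≢4σ {P} {c} 5≤P σ-sign P*c*c≡4σ with c ≟ 0ℤ
  ... | yes refl = 0≢4σ σ-sign (trans (sym (P*0*0 P)) P*c*c≡4σ)
    where
    P*0*0 : ∀ P → P * 0ℤ * 0ℤ ≡ 0ℤ
    P*0*0 = solve-∀
    0≢4σ : ∀ {σ} → IsSign σ → 0ℤ ≢ + 4 * σ
    0≢4σ (inj₁ refl) ()
    0≢4σ (inj₂ refl) ()
  ... | no c≢0 = <⇒≱ (toWitness {a? = + 4 <? + 5} _)
                   (≤-trans 5≤P (≤-trans (≤-*-square 0≤P c≢0) (≤-trans (≤-reflexive P*c*c≡4σ) (4σ≤4 σ-sign))))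
    where
    0≤P : 0ℤ ≤ P
    0≤P = ≤-trans (+≤+ ℕ.z≤n) 5≤P
    4σ≤4 : ∀ {σ} → IsSign σ → + 4 * σ ≤ + 4
    4σ≤4 (inj₁ refl) = ≤-refl
    4σ≤4 (inj₂ refl) = -≤+

  i<1+∣i∣ : ∀ {i} → 0ℤ ≤ i → i < + ℕ.suc ∣ i ∣
  i<1+∣i∣ {i} 0≤i = subst (_< + ℕ.suc ∣ i ∣) (0≤i⇒+∣i∣≡i 0≤i) (+<+ (ℕ.n<1+n ∣ i ∣))

  ∣i∣≡n⇒i≡±n : ∀ {i n} → ∣ i ∣ ≡ n → Σ ℤ λ σ → IsSign σ × i ≡ σ * + n
  ∣i∣≡n⇒i≡±n {+ m}      refl = 1ℤ , inj₁ refl , sym (*-identityˡ (+ m))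
  ∣i∣≡n⇒i≡±n { -[1+ m ]} refl = -1ℤ , inj₂ refl , sym (-1*i≡-i (+ ℕ.suc m))

  prime∣square⇒∣ : ∀ {p} i → Prime p → + p ∣ i * i → + p ∣ i
  prime∣square⇒∣ i p-prime p∣i*i =
    [ id , id ]′ (euclidsLemma ∣ i ∣ ∣ i ∣ p-prime (subst (_ ℕ.∣_) (abs-* i i) p∣i*i))

  halve-sum : ∀ u v k → u * u - v * v ≡ + 2 * k → Σ ℤ λ h → u + v ≡ + 2 * h
  halve-sum u v k eq = Signed.quotient 2∣u+v , trans (Signed._∣_.equality 2∣u+v) (*-comm _ (+ 2))
    where
    expand : ∀ u v k → (u + v) * (u + v) ≡ (k + v * (u + v)) * + 2 + + 1 * ((u * u - v * v) - + 2 * k)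
    expand = solve-∀
    2∣u+v : + 2 Signed.∣ u + v
    2∣u+v = Signed.∣ᵤ⇒∣ (prime∣square⇒∣ (u + v) prime[2]
              (Signed.∣⇒∣ᵤ {+ 2} (Signed.divides (k + v * (u + v)) (≡-modulo₁ eq (+ 1) (expand u v k)))))

module RingOfIntegers (d : ℤ) where
  open IntegerFacts
  open import Data.Integer
  open import Data.Integer.Properties
  open import Data.Integer.Tactic.RingSolver using (solve-∀)
  open import Data.Integer.Divisibility using (_∣_)
  import Data.Integer.Divisibility.Signed as Signed
  open import Data.Product using (proj₁; proj₂)
  open import Relation.Binary.PropositionalEquality using (cong₂; module ≡-Reasoning)
  open import Relation.Nullary.Decidable using (toWitness)

  NormIs⇒IsInt : ∀ {α n} → NormIs d α n → IsInt d α
  NormIs⇒IsInt {α} {n} N = Signed.∣⇒∣ᵤ (Signed.divides n (trans N (*-comm (+ 4) n)))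

  IsInt⇒norm : ∀ {α} → IsInt d α → Σ ℤ (NormIs d α)
  IsInt⇒norm 4∣N with Signed.∣ᵤ⇒∣ {+ 4} 4∣N
  ... | Signed.divides n eq = n , trans eq (*-comm n (+ 4))

  norm-unique : ∀ {α m n} → NormIs d α m → NormIs d α n → m ≡ n
  norm-unique Nm Nn = *-cancelˡ-≡ (+ 4) _ _ (trans (sym Nm) Nn)

  norm-mul : ∀ {α γ δ m n} → NormIs d α m → NormIs d γ n → MulIs d α γ δ → NormIs d δ (m * n)
  norm-mul {a , b} {c , e} {x , y} {m} {n} Nα Nγ (x-eq , y-eq) = *-cancelˡ-≡ (+ 4) _ _ (begin
    + 4 * (x * x - d * y * y)
      ≡⟨ scale x y d ⟩
    (+ 2 * x) * (+ 2 * x) - d * (+ 2 * y) * (+ 2 * y)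
      ≡⟨ cong₂ (λ u v → u * u - d * v * v) (sym x-eq) (sym y-eq) ⟩
    (a * c + d * b * e) * (a * c + d * b * e) - d * (a * e + b * c) * (a * e + b * c)
      ≡⟨ brahmagupta a b c e d ⟩
    (a * a - d * b * b) * (c * c - d * e * e)
      ≡⟨ cong₂ _*_ Nα Nγ ⟩
    (+ 4 * m) * (+ 4 * n)
      ≡⟨ scale′ m n ⟩
    + 4 * (+ 4 * (m * n)) ∎)
    where
    open ≡-Reasoning
    scale : ∀ x y d → + 4 * (x * x - d * y * y) ≡ (+ 2 * x) * (+ 2 * x) - d * (+ 2 * y) * (+ 2 * y)
    scale = solve-∀
    brahmagupta : ∀ a b c e d →
      (a * c + d * b * e) * (a * c + d * b * e) - d * (a * e + b * c) * (a * e + b * c) ≡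
      (a * a - d * b * b) * (c * c - d * e * e)
    brahmagupta = solve-∀
    scale′ : ∀ m n → (+ 4 * m) * (+ 4 * n) ≡ + 4 * (+ 4 * (m * n))
    scale′ = solve-∀

  -- Each coordinate of a product is a sum u + v with u² ≡ v² (mod 4), hence even.
  product-exists : ∀ {α γ} → IsInt d α → IsInt d γ → Σ Elem (MulIs d α γ)
  product-exists {α} {γ} α-int γ-int =
    from-norms {α} {γ} (proj₂ (IsInt⇒norm {α} α-int)) (proj₂ (IsInt⇒norm {γ} γ-int))
    where
    from-norms : ∀ {α γ m n} → NormIs d α m → NormIs d γ n → Σ Elem (MulIs d α γ)
    from-norms {a , b} {c , e} {m} {n} Nα Nγ =
      (proj₁ x-half , proj₁ y-half) , proj₂ x-half , proj₂ y-half
      where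
      x-identity : ∀ a b c e d m n →
        (a * c) * (a * c) - (d * b * e) * (d * b * e) ≡
        + 2 * (+ 2 * (a * a * n + d * e * e * m)) +
        (d * e * e) * ((a * a - d * b * b) - + 4 * m) + (a * a) * ((c * c - d * e * e) - + 4 * n)
      x-identity = solve-∀
      y-identity : ∀ a b c e d m n →
        (a * e) * (a * e) - (b * c) * (b * c) ≡
        + 2 * (+ 2 * (e * e * m - b * b * n)) +
        (e * e) * ((a * a - d * b * b) - + 4 * m) + (- (b * b)) * ((c * c - d * e * e) - + 4 * n)
      y-identity = solve-∀
      x-half = halve-sum (a * c) (d * b * e) (+ 2 * (a * a * n + d * e * e * m))
        (≡-modulo₂ Nα Nγ (d * e * e) (a * a) (x-identity a b c e d m n))
      y-half = halve-sum (a * e) (b * c) (+ 2 * (e * e * m - b * b * n))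
        (≡-modulo₂ Nα Nγ (e * e) (- (b * b)) (y-identity a b c e d m n))

  norm-sign⇒unit : ∀ {α σ} → IsSign σ → NormIs d α σ → IsUnit d α
  norm-sign⇒unit {a , b} {σ} σ-sign N =
    NormIs⇒IsInt {a , b} N , (σ * a , - (σ * b)) , NormIs⇒IsInt {σ * a , - (σ * b)} N⁻¹ ,
    ≡-modulo₂ N σ² σ (+ 4) (re-identity a b d σ) , im-identity a b σ
    where
    σ² : σ * σ ≡ 1ℤ
    σ² = sign-square σ-sign
    norm-identity : ∀ a b d σ →
      (σ * a) * (σ * a) - d * - (σ * b) * - (σ * b) ≡
      + 4 * σ + (σ * σ) * ((a * a - d * b * b) - + 4 * σ) + (+ 4 * σ) * (σ * σ - 1ℤ)
    norm-identity = solve-∀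
    re-identity : ∀ a b d σ →
      a * (σ * a) + d * b * - (σ * b) ≡
      + 2 * + 2 + σ * ((a * a - d * b * b) - + 4 * σ) + (+ 4) * (σ * σ - 1ℤ)
    re-identity = solve-∀
    im-identity : ∀ a b σ → a * - (σ * b) + b * (σ * a) ≡ + 2 * + 0
    im-identity = solve-∀
    N⁻¹ : NormIs d (σ * a , - (σ * b)) σ
    N⁻¹ = ≡-modulo₂ N σ² (σ * σ) (+ 4 * σ) (norm-identity a b d σ)

  norm≡-1⇒y≢0 : ∀ {x y} → NormIs d (x , y) -1ℤ → y ≢ 0ℤ
  norm≡-1⇒y≢0 {x} N refl =
    <⇒≱ (toWitness {a? = -[1+ 3 ] <? 0ℤ} _) (subst (0ℤ ≤_) (≡-modulo₁ N (+ 1) (identity x d)) (0≤i*i x))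
    where
    identity : ∀ x d → x * x ≡ -[1+ 3 ] + + 1 * ((x * x - d * 0ℤ * 0ℤ) - + 4 * -1ℤ)
    identity = solve-∀

  divides⇒norm∣ : ∀ {α β m n} → Divides d α β → NormIs d α m → NormIs d β n → m ∣ n
  divides⇒norm∣ {α} {β} {m} (γ , γ-int , α*γ≡β) Nα Nβ =
    Signed.∣⇒∣ᵤ (Signed.divides k (trans (norm-unique {β} Nβ (norm-mul {α} {γ} {β} Nα Nγ α*γ≡β)) (*-comm m k)))
    where
    k : ℤ
    k = proj₁ (IsInt⇒norm {γ} γ-int)
    Nγ : NormIs d γ k
    Nγ = proj₂ (IsInt⇒norm {γ} γ-int)

module FundamentalUnit {d e₁ e₂ : ℤ} (9≤d : + 9 ≤ d)
  (ε-fundamental : IsFundamentalUnit d (e₁ , e₂)) (Nε : NormIs d (e₁ , e₂) -1ℤ) where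
  open IntegerFacts
  open RingOfIntegers d
  open import Data.Integer
  open import Data.Integer.Properties
  open import Data.Integer.Tactic.RingSolver using (solve-∀)
  open import Data.Product using (proj₁; proj₂)
  open import Relation.Nullary.Decidable using (toWitness)

  0≤d : 0ℤ ≤ d
  0≤d = ≤-trans (+≤+ ℕ.z≤n) 9≤d

  e₂≢0 : e₂ ≢ 0ℤ
  e₂≢0 = norm≡-1⇒y≢0 {e₁} Nε

  ε-coordinates : + 2 ≤ e₁ × 0ℤ < e₂
  ε-coordinates = from-Pos (subst (Pos d (e₁ - + 2)) (+-identityʳ e₂) (proj₁ (proj₂ ε-fundamental)))
    where
    identity : ∀ d e₁ e₂ →
      d * e₂ * e₂ - (e₁ - + 2) * (e₁ - + 2) ≡ + 4 * e₁ + -1ℤ * ((e₁ * e₁ - d * e₂ * e₂) - + 4 * -1ℤ)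
    identity = solve-∀
    gap : d * e₂ * e₂ - (e₁ - + 2) * (e₁ - + 2) ≡ + 4 * e₁
    gap = ≡-modulo₁ Nε -1ℤ (identity d e₁ e₂)
    from-Pos : Pos d (e₁ - + 2) e₂ → + 2 ≤ e₁ × 0ℤ < e₂
    from-Pos (inj₁ (0≤e₁-2 , 0≤e₂ , _)) = 0≤i-j⇒j≤i 0≤e₁-2 , ≤∧≢⇒< 0≤e₂ (e₂≢0 ∘ sym)
    from-Pos (inj₂ (inj₁ (0≤e₁-2 , _ , dε²<))) =
      ⊥-elim (<⇒≱ dε²< (0≤i-j⇒j≤i (subst (0ℤ ≤_) (sym gap) 0≤4e₁)))
      where
      0≤4e₁ : 0ℤ ≤ + 4 * e₁
      0≤4e₁ = 0≤i*j {+ 4} {e₁} (+≤+ ℕ.z≤n) (≤-trans (+≤+ ℕ.z≤n) (0≤i-j⇒j≤i 0≤e₁-2))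
    from-Pos (inj₂ (inj₂ (e₁-2<0 , _ , <dε²))) = ⊥-elim (<⇒≱ (toWitness {a? = + 5 <? + 9} _) 9≤5)
      where
      0<e₁ : 0ℤ < e₁
      0<e₁ = *-cancelˡ-<-nonNeg {i = 0ℤ} (+ 4) (subst (0ℤ <_) gap (i<j⇒0<j-i <dε²))
      e₁≡1 : e₁ ≡ + 1
      e₁≡1 = ≤-antisym (i<j⇒i≤pred[j] (i-j<0⇒i<j e₁-2<0)) (i<j⇒suc[i]≤j 0<e₁)
      dε²-identity : ∀ d e₁ e₂ → d * e₂ * e₂ ≡ e₁ * e₁ + + 4 + -1ℤ * ((e₁ * e₁ - d * e₂ * e₂) - + 4 * -1ℤ)
      dε²-identity = solve-∀
      dε²≡5 : d * e₂ * e₂ ≡ + 5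
      dε²≡5 = trans (≡-modulo₁ Nε -1ℤ (dε²-identity d e₁ e₂)) (cong (λ t → t * t + + 4) e₁≡1)
      9≤5 : + 9 ≤ + 5
      9≤5 = ≤-trans 9≤d (≤-trans (≤-*-square {d} {e₂} 0≤d e₂≢0) (≤-reflexive dε²≡5))

  0≤e₁ : 0ℤ ≤ e₁
  0≤e₁ = ≤-trans (+≤+ ℕ.z≤n) (proj₁ ε-coordinates)

  0<e₂ : 0ℤ < e₂
  0<e₂ = proj₂ ε-coordinates

  positive⇒Gt-one : ∀ {x y} → 0ℤ < x → 0ℤ < y → Gt d (x , y) one
  positive⇒Gt-one {+[1+ ℕ.zero ]} {y} _ 0<y rewrite +-identityʳ y =
    inj₂ (inj₂ (-<+ , <⇒≤ 0<y , <-≤-trans (toWitness {a? = + 1 <? + 9} _)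
      (≤-trans 9≤d (≤-*-square {d} {y} 0≤d (<⇒≢ 0<y ∘ sym)))))
  positive⇒Gt-one {+[1+ ℕ.suc k ]} {y} _ 0<y rewrite +-identityʳ y =
    inj₁ (+≤+ ℕ.z≤n , <⇒≤ 0<y , inj₂ 0<y)
  positive⇒Gt-one {+ ℕ.zero} (+<+ ())

  -- A unit x + y√d > 1 with x ≥ e₁ but y < e₂ would force d ≤ 8.
  e₂≤y : ∀ {x y σ} → IsSign σ → 0ℤ < x → 0ℤ < y → NormIs d (x , y) σ → e₂ ≤ y
  e₂≤y {x} {y} {σ} σ-sign 0<x 0<y N =
    from-Ge (proj₂ (proj₂ ε-fundamental) (x , y) (norm-sign⇒unit {x , y} σ-sign N) (positive⇒Gt-one 0<x 0<y))
    where
    from-Ge : Ge d (x , y) (e₁ , e₂) → e₂ ≤ y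
    from-Ge (inj₂ refl) = ≤-refl
    from-Ge (inj₁ (inj₁ (_ , 0≤y-e₂ , _))) = 0≤i-j⇒j≤i 0≤y-e₂
    from-Ge (inj₁ (inj₂ (inj₂ (_ , 0≤y-e₂ , _)))) = 0≤i-j⇒j≤i 0≤y-e₂
    from-Ge (inj₁ (inj₂ (inj₁ (0≤x-e₁ , y-e₂<0 , _)))) =
      ⊥-elim (<⇒≱ (toWitness {a? = + 8 <? + 9} _) (≤-trans 9≤d d≤8))
      where
      identity : ∀ d x y e₁ e₂ σ →
        d * (e₂ * e₂ - y * y) ≡
        (e₁ * e₁ - x * x) + + 4 * (1ℤ + σ) +
        -1ℤ * ((e₁ * e₁ - d * e₂ * e₂) - + 4 * -1ℤ) + + 1 * ((x * x - d * y * y) - + 4 * σ)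
      identity = solve-∀
      1≤e₂²-y² : 1ℤ ≤ e₂ * e₂ - y * y
      1≤e₂²-y² = i<j⇒suc[i]≤j (i<j⇒0<j-i (square-mono-< (<⇒≤ 0<y) (i-j<0⇒i<j y-e₂<0)))
      e₁²≤x² : e₁ * e₁ ≤ x * x
      e₁²≤x² = square-mono-≤ 0≤e₁ (0≤i-j⇒j≤i {x} 0≤x-e₁)
      4[1+σ]≤8 : ∀ {σ} → IsSign σ → + 4 * (1ℤ + σ) ≤ + 8
      4[1+σ]≤8 (inj₁ refl) = ≤-refl
      4[1+σ]≤8 (inj₂ refl) = +≤+ ℕ.z≤n
      d≤8 : d ≤ + 8
      d≤8 = begin
        d                                   ≡⟨ sym (*-identityʳ d) ⟩
        d * 1ℤ                              ≤⟨ *-monoˡ-≤-nonNeg d {{nonNegative 0≤d}} 1≤e₂²-y² ⟩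
        d * (e₂ * e₂ - y * y)               ≡⟨ ≡-modulo₂ Nε N -1ℤ (+ 1) (identity d x y e₁ e₂ σ) ⟩
        (e₁ * e₁ - x * x) + + 4 * (1ℤ + σ)  ≤⟨ +-mono-≤ (i≤j⇒i-j≤0 e₁²≤x²) (4[1+σ]≤8 σ-sign) ⟩
        + 8                                 ∎
        where open ≤-Reasoning

  -- ε⁻¹ = -ε̄ because N(ε) = -1.
  ε⁻¹ : Elem
  ε⁻¹ = (- e₁ , e₂)

  Nε⁻¹ : NormIs d ε⁻¹ -1ℤ
  Nε⁻¹ = ≡-modulo₁ Nε (+ 1) (identity d e₁ e₂)
    where
    identity : ∀ d e₁ e₂ →
      - e₁ * - e₁ - d * e₂ * e₂ ≡ + 4 * -1ℤ + + 1 * ((e₁ * e₁ - d * e₂ * e₂) - + 4 * -1ℤ)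
    identity = solve-∀

  ε⁻¹-int : IsInt d ε⁻¹
  ε⁻¹-int = NormIs⇒IsInt {ε⁻¹} { -1ℤ} Nε⁻¹

  divide-by-ε : ∀ {u σ} → NormIs d u σ → Σ Elem λ v → MulIs d u ε⁻¹ v
  divide-by-ε {u} {σ} N = product-exists {u} {ε⁻¹} (NormIs⇒IsInt {u} {σ} N) ε⁻¹-int

  quotient-norm : ∀ {u v σ} → NormIs d u σ → MulIs d u ε⁻¹ v → NormIs d v (- σ)
  quotient-norm {u} {v} {σ} N u/ε≡v =
    subst (NormIs d v) (trans (*-comm σ -1ℤ) (-1*i≡-i σ)) (norm-mul {u} {ε⁻¹} {v} {σ} { -1ℤ} N Nε⁻¹ u/ε≡v)

  quotient-coordinates : ∀ {x y x′ y′} → MulIs d (x , y) ε⁻¹ (x′ , y′) →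
                         d * y * e₂ - x * e₁ ≡ + 2 * x′ × x * e₂ - y * e₁ ≡ + 2 * y′
  quotient-coordinates {x} {y} {x′} {y′} (x-eq , y-eq) =
    ≡-modulo₁ x-eq (+ 1) (x′-identity d x y e₁ e₂ x′) , ≡-modulo₁ y-eq (+ 1) (y′-identity x y e₁ e₂ y′)
    where
    x′-identity : ∀ d x y e₁ e₂ x′ →
      d * y * e₂ - x * e₁ ≡ + 2 * x′ + + 1 * ((x * - e₁ + d * y * e₂) - + 2 * x′)
    x′-identity = solve-∀
    y′-identity : ∀ x y e₁ e₂ y′ →
      x * e₂ - y * e₁ ≡ + 2 * y′ + + 1 * ((x * e₂ + y * - e₁) - + 2 * y′)
    y′-identity = solve-∀

  quotient-y<y : ∀ {x y σ x′ y′} → IsSign σ → 0ℤ < x → 0ℤ < y → NormIs d (x , y) σ →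
                 MulIs d (x , y) ε⁻¹ (x′ , y′) → y′ < y
  quotient-y<y {x} {y} {σ} {x′} {y′} σ-sign 0<x 0<y N u/ε≡v =
    *-cancelˡ-<-nonNeg (+ 2) (0<j-i⇒i<j (subst (0ℤ <_) gap (i<j⇒0<j-i xe₂<y[e₁+2])))
    where
    gap-identity : ∀ x y e₁ e₂ → y * (e₁ + + 2) - x * e₂ ≡ + 2 * y - (x * e₂ - y * e₁)
    gap-identity = solve-∀
    gap : y * (e₁ + + 2) - x * e₂ ≡ + 2 * y - + 2 * y′
    gap = trans (gap-identity x y e₁ e₂)
                (cong (λ t → + 2 * y - t) (proj₂ (quotient-coordinates {x} {y} {x′} {y′} u/ε≡v)))
    square-identity : ∀ d x y e₁ e₂ σ →
      (y * (e₁ + + 2)) * (y * (e₁ + + 2)) - (x * e₂) * (x * e₂) ≡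
      + 4 * ((e₁ - 1ℤ) * (y * y) + (y * y - σ * (e₂ * e₂))) +
      (- (e₂ * e₂)) * ((x * x - d * y * y) - + 4 * σ) + (y * y) * ((e₁ * e₁ - d * e₂ * e₂) - + 4 * -1ℤ)
    square-identity = solve-∀
    σe₂²≤y² : IsSign σ → σ * (e₂ * e₂) ≤ y * y
    σe₂²≤y² (inj₁ refl) =
      subst (_≤ y * y) (sym (*-identityˡ _)) (square-mono-≤ (<⇒≤ 0<e₂) (e₂≤y σ-sign 0<x 0<y N))
    σe₂²≤y² (inj₂ refl) =
      ≤-trans (≤-reflexive (-1*i≡-i (e₂ * e₂))) (≤-trans (neg-mono-≤ (0≤i*i e₂)) (0≤i*i y))
    0<e₁-1 : 0ℤ < e₁ - 1ℤ
    0<e₁-1 = i<j⇒0<j-i (<-≤-trans (toWitness {a? = + 1 <? + 2} _) (proj₁ ε-coordinates))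
    xe₂<y[e₁+2] : x * e₂ < y * (e₁ + + 2)
    xe₂<y[e₁+2] = <-from-squares (0≤i*j {y} {e₁ + + 2} (<⇒≤ 0<y) (≤-trans 0≤e₁ (i≤i+j e₁ (+ 2))))
      (≡-modulo₂ N Nε (- (e₂ * e₂)) (y * y) (square-identity d x y e₁ e₂ σ))
      (0<i*j {+ 4} (+<+ (ℕ.s≤s ℕ.z≤n))
        (+-mono-<-≤ (0<i*j 0<e₁-1 (0<i*i (<⇒≢ 0<y ∘ sym))) (i≤j⇒0≤j-i (σe₂²≤y² σ-sign))))

  quotient-of-norm-1 : ∀ {x y x′ y′} → 0ℤ < x → 0ℤ < y → NormIs d (x , y) 1ℤ →
                       MulIs d (x , y) ε⁻¹ (x′ , y′) → 0ℤ < x′ × 0ℤ < y′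
  quotient-of-norm-1 {x} {y} {x′} {y′} 0<x 0<y N u/ε≡v =
    *-cancelˡ-<-nonNeg {i = 0ℤ} (+ 2) (subst (0ℤ <_) twice-x′ (i<j⇒0<j-i xe₁<dye₂)) ,
    *-cancelˡ-<-nonNeg {i = 0ℤ} (+ 2) (subst (0ℤ <_) twice-y′ (i<j⇒0<j-i ye₁<xe₂))
    where
    twice-x′ : d * y * e₂ - x * e₁ ≡ + 2 * x′
    twice-x′ = proj₁ (quotient-coordinates {x} {y} {x′} {y′} u/ε≡v)
    twice-y′ : x * e₂ - y * e₁ ≡ + 2 * y′
    twice-y′ = proj₂ (quotient-coordinates {x} {y} {x′} {y′} u/ε≡v)
    x-square-identity : ∀ d x y e₁ e₂ →
      (d * y * e₂) * (d * y * e₂) - (x * e₁) * (x * e₁) ≡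
      + 4 * (d * (y * y - e₂ * e₂) + + 4) +
      (+ 4 - d * e₂ * e₂) * ((x * x - d * y * y) - + 4 * 1ℤ) + (- (x * x)) * ((e₁ * e₁ - d * e₂ * e₂) - + 4 * -1ℤ)
    x-square-identity = solve-∀
    y-square-identity : ∀ d x y e₁ e₂ →
      (x * e₂) * (x * e₂) - (y * e₁) * (y * e₁) ≡
      + 4 * (y * y + e₂ * e₂) +
      (e₂ * e₂) * ((x * x - d * y * y) - + 4 * 1ℤ) + (- (y * y)) * ((e₁ * e₁ - d * e₂ * e₂) - + 4 * -1ℤ)
    y-square-identity = solve-∀
    0≤y²-e₂² : 0ℤ ≤ y * y - e₂ * e₂
    0≤y²-e₂² = i≤j⇒0≤j-i (square-mono-≤ (<⇒≤ 0<e₂) (e₂≤y (inj₁ refl) 0<x 0<y N))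
    xe₁<dye₂ : x * e₁ < d * y * e₂
    xe₁<dye₂ = <-from-squares (0≤i*j {d * y} {e₂} (0≤i*j {d} {y} 0≤d (<⇒≤ 0<y)) (<⇒≤ 0<e₂))
      (≡-modulo₂ N Nε (+ 4 - d * e₂ * e₂) (- (x * x)) (x-square-identity d x y e₁ e₂))
      (0<i*j {+ 4} (+<+ (ℕ.s≤s ℕ.z≤n)) (+-mono-≤-< (0≤i*j {d} 0≤d 0≤y²-e₂²) (+<+ (ℕ.s≤s ℕ.z≤n))))
    ye₁<xe₂ : y * e₁ < x * e₂
    ye₁<xe₂ = <-from-squares (0≤i*j {x} {e₂} (<⇒≤ 0<x) (<⇒≤ 0<e₂))
      (≡-modulo₂ N Nε (e₂ * e₂) (- (y * y)) (y-square-identity d x y e₁ e₂))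
      (0<i*j {+ 4} (+<+ (ℕ.s≤s ℕ.z≤n)) (+-mono-<-≤ (0<i*i (<⇒≢ 0<y ∘ sym)) (0≤i*i e₂)))

  quotient-of-norm-−1 : ∀ {x y x′ y′} → 0ℤ < x → 0ℤ < y → NormIs d (x , y) -1ℤ →
                        MulIs d (x , y) ε⁻¹ (x′ , y′) → 0ℤ ≤ y′
  quotient-of-norm-−1 {x} {y} {x′} {y′} 0<x 0<y N u/ε≡v =
    *-cancelˡ-≤-pos 0ℤ y′ (+ 2)
      (subst (0ℤ ≤_) (proj₂ (quotient-coordinates {x} {y} {x′} {y′} u/ε≡v)) (i≤j⇒0≤j-i ye₁≤xe₂))
    where
    square-identity : ∀ d x y e₁ e₂ →
      (x * e₂) * (x * e₂) - (y * e₁) * (y * e₁) ≡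
      + 4 * (y * y - e₂ * e₂) +
      (e₂ * e₂) * ((x * x - d * y * y) - + 4 * -1ℤ) + (- (y * y)) * ((e₁ * e₁ - d * e₂ * e₂) - + 4 * -1ℤ)
    square-identity = solve-∀
    ye₁≤xe₂ : y * e₁ ≤ x * e₂
    ye₁≤xe₂ = ≤-from-squares (0≤i*j {x} {e₂} (<⇒≤ 0<x) (<⇒≤ 0<e₂))
      (≡-modulo₂ N Nε (e₂ * e₂) (- (y * y)) (square-identity d x y e₁ e₂))
      (0≤i*j {+ 4} (+≤+ ℕ.z≤n) (i≤j⇒0≤j-i (square-mono-≤ (<⇒≤ 0<e₂) (e₂≤y (inj₂ refl) 0<x 0<y N))))

module NormEquation (R Q : ℤ) where
  open import Data.Integer using (_*_; _-_)

  -- (a√Q + b√R)/2 has norm s.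
  Solves : ℤ → ℤ → ℤ → Set
  Solves a b s = Q * a * a - R * b * b ≡ + 4 * s

module Descent {R Q e₁ e₂ : ℤ} (5≤R : + 5 ≤ R) (5≤Q : + 5 ≤ Q)
  (ε-fundamental : IsFundamentalUnit (R ℤ.* Q) (e₁ , e₂)) (Nε : NormIs (R ℤ.* Q) (e₁ , e₂) -1ℤ) where
  open IntegerFacts
  open NormEquation R Q
  open import Data.Integer
  open import Data.Integer.Properties
  open import Data.Integer.Tactic.RingSolver using (solve-∀)
  open import Data.Empty using (⊥)
  open import Data.Product using (proj₁; proj₂)
  open import Relation.Binary.PropositionalEquality using (cong₂; module ≡-Reasoning)
  open import Relation.Nullary using (yes; no)
  open import Relation.Nullary.Decidable using (toWitness)

  0≤R : 0ℤ ≤ R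
  0≤R = ≤-trans (+≤+ ℕ.z≤n) 5≤R

  9≤d : + 9 ≤ R * Q
  9≤d = ≤-trans (toWitness {a? = + 9 ≤? + 25} _)
          (≤-trans (*-monoʳ-≤-nonNeg (+ 5) 5≤R) (*-monoˡ-≤-nonNeg R {{nonNegative 0≤R}} 5≤Q))

  open FundamentalUnit 9≤d ε-fundamental Nε

  solution-factors-nonzero : ∀ {a b s} → IsSign s → Solves a b s → a * b ≢ 0ℤ
  solution-factors-nonzero {a} {b} {s} s-sign H ab≡0 = from-factor (i*j≡0⇒i≡0∨j≡0 a ab≡0)
    where
    a≡0-identity : ∀ Q R b s → R * b * b ≡ + 4 * (- s) + -1ℤ * ((Q * 0ℤ * 0ℤ - R * b * b) - + 4 * s)
    a≡0-identity = solve-∀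
    b≡0-identity : ∀ Q R a s → Q * a * a ≡ + 4 * s + + 1 * ((Q * a * a - R * 0ℤ * 0ℤ) - + 4 * s)
    b≡0-identity = solve-∀
    from-factor : a ≡ 0ℤ ⊎ b ≡ 0ℤ → ⊥
    from-factor (inj₁ refl) = 5≤P⇒P*c*c≢4σ 5≤R (sign-neg s-sign) (≡-modulo₁ H -1ℤ (a≡0-identity Q R b s))
    from-factor (inj₂ refl) = 5≤P⇒P*c*c≢4σ 5≤Q s-sign (≡-modulo₁ H (+ 1) (b≡0-identity Q R a s))

  -- ((a√Q + b√R)/2)² = (x + y√d)/2 with x = R b² + 2s, y = a b.
  square-norm : ∀ {a b s} → IsSign s → Solves a b s → NormIs (R * Q) (R * b * b + + 2 * s , a * b) 1ℤ
  square-norm {a} {b} {s} s-sign H = ≡-modulo₂ H (sign-square s-sign) (- (R * b * b)) (+ 4) (identity R Q a b s)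
    where
    identity : ∀ R Q a b s →
      (R * b * b + + 2 * s) * (R * b * b + + 2 * s) - (R * Q) * (a * b) * (a * b) ≡
      + 4 * 1ℤ + (- (R * b * b)) * ((Q * a * a - R * b * b) - + 4 * s) + (+ 4) * (s * s - 1ℤ)
    identity = solve-∀

  -- (a′√Q + b′√R)/2 = ((a√Q + b√R)/2) · ε⁻¹.
  next-solution : ∀ {a b s} → Solves a b s →
    Σ ℤ λ a′ → Σ ℤ λ b′ → R * b * e₂ - a * e₁ ≡ + 2 * a′ × Q * a * e₂ - b * e₁ ≡ + 2 * b′ × Solves a′ b′ (- s)
  next-solution {a} {b} {s} H = proj₁ a-half , proj₁ b-half , proj₂ a-half , proj₂ b-half ,
    *-cancelˡ-≡ (+ 4) _ _ (begin
      + 4 * (Q * a′ * a′ - R * b′ * b′)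
        ≡⟨ scale Q R a′ b′ ⟩
      Q * (+ 2 * a′) * (+ 2 * a′) - R * (+ 2 * b′) * (+ 2 * b′)
        ≡⟨ cong₂ (λ u v → Q * u * u - R * v * v) (sym (proj₂ a-half)) (sym (proj₂ b-half)) ⟩
      Q * (R * b * e₂ - a * e₁) * (R * b * e₂ - a * e₁) - R * (Q * a * e₂ - b * e₁) * (Q * a * e₂ - b * e₁)
        ≡⟨ norm-product R Q a b e₁ e₂ ⟩
      (Q * a * a - R * b * b) * (e₁ * e₁ - (R * Q) * e₂ * e₂)
        ≡⟨ cong₂ _*_ H Nε ⟩
      (+ 4 * s) * (+ 4 * -1ℤ)
        ≡⟨ scale′ s ⟩
      + 4 * (+ 4 * (- s)) ∎)
    where
    open ≡-Reasoning
    a-identity : ∀ R Q a b s e₁ e₂ →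
      (R * b * e₂) * (R * b * e₂) - (- (a * e₁)) * (- (a * e₁)) ≡
      + 2 * (+ 2 * (a * a - s * R * e₂ * e₂)) +
      (- (R * e₂ * e₂)) * ((Q * a * a - R * b * b) - + 4 * s) +
      (- (a * a)) * ((e₁ * e₁ - (R * Q) * e₂ * e₂) - + 4 * -1ℤ)
    a-identity = solve-∀
    b-identity : ∀ R Q a b s e₁ e₂ →
      (Q * a * e₂) * (Q * a * e₂) - (- (b * e₁)) * (- (b * e₁)) ≡
      + 2 * (+ 2 * (s * Q * e₂ * e₂ + b * b)) +
      (Q * e₂ * e₂) * ((Q * a * a - R * b * b) - + 4 * s) +
      (- (b * b)) * ((e₁ * e₁ - (R * Q) * e₂ * e₂) - + 4 * -1ℤ)
    b-identity = solve-∀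
    a-half : Σ ℤ λ h → R * b * e₂ - a * e₁ ≡ + 2 * h
    a-half = halve-sum (R * b * e₂) (- (a * e₁)) (+ 2 * (a * a - s * R * e₂ * e₂))
      (≡-modulo₂ H Nε (- (R * e₂ * e₂)) (- (a * a)) (a-identity R Q a b s e₁ e₂))
    b-half : Σ ℤ λ h → Q * a * e₂ - b * e₁ ≡ + 2 * h
    b-half = halve-sum (Q * a * e₂) (- (b * e₁)) (+ 2 * (s * Q * e₂ * e₂ + b * b))
      (≡-modulo₂ H Nε (Q * e₂ * e₂) (- (b * b)) (b-identity R Q a b s e₁ e₂))
    a′ b′ : ℤ
    a′ = proj₁ a-half
    b′ = proj₁ b-half
    scale : ∀ Q R a′ b′ → + 4 * (Q * a′ * a′ - R * b′ * b′) ≡ Q * (+ 2 * a′) * (+ 2 * a′) - R * (+ 2 * b′) * (+ 2 * b′)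
    scale = solve-∀
    norm-product : ∀ R Q a b e₁ e₂ →
      Q * (R * b * e₂ - a * e₁) * (R * b * e₂ - a * e₁) - R * (Q * a * e₂ - b * e₁) * (Q * a * e₂ - b * e₁) ≡
      (Q * a * a - R * b * b) * (e₁ * e₁ - (R * Q) * e₂ * e₂)
    norm-product = solve-∀
    scale′ : ∀ s → (+ 4 * s) * (+ 4 * -1ℤ) ≡ + 4 * (+ 4 * (- s))
    scale′ = solve-∀

  -- a′ b′ is the √d-coordinate of η ε⁻², where η = ((a√Q + b√R)/2)².
  next-product : ∀ {a b s a′ b′ x′ y′ x″ y″} → Solves a b s →
    R * b * e₂ - a * e₁ ≡ + 2 * a′ → Q * a * e₂ - b * e₁ ≡ + 2 * b′ →
    MulIs (R * Q) (R * b * b + + 2 * s , a * b) ε⁻¹ (x′ , y′) → MulIs (R * Q) (x′ , y′) ε⁻¹ (x″ , y″) →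
    a′ * b′ ≡ y″
  next-product {a} {b} {s} {a′} {b′} {x′} {y′} {x″} {y″} H a-eq b-eq (x′-eq , y′-eq) (_ , y″-eq) =
    *-cancelˡ-≡ (+ 4) _ _ (begin
      + 4 * (a′ * b′)
        ≡⟨ scale a′ b′ ⟩
      (+ 2 * a′) * (+ 2 * b′)
        ≡⟨ cong₂ _*_ (sym a-eq) (sym b-eq) ⟩
      (R * b * e₂ - a * e₁) * (Q * a * e₂ - b * e₁)
        ≡⟨ ≡-modulo₁ H (- (e₁ * e₂)) (identity R Q a b s e₁ e₂) ⟩
      ((R * b * b + + 2 * s) * - e₁ + (R * Q) * (a * b) * e₂) * e₂ +
      ((R * b * b + + 2 * s) * e₂ + (a * b) * - e₁) * - e₁
        ≡⟨ cong₂ (λ u v → u * e₂ + v * - e₁) x′-eq y′-eq ⟩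
      (+ 2 * x′) * e₂ + (+ 2 * y′) * - e₁
        ≡⟨ scale′ x′ y′ e₁ e₂ ⟩
      + 2 * (x′ * e₂ + y′ * - e₁)
        ≡⟨ cong (λ t → + 2 * t) y″-eq ⟩
      + 2 * (+ 2 * y″)
        ≡⟨ scale″ y″ ⟩
      + 4 * y″ ∎)
    where
    open ≡-Reasoning
    scale : ∀ a′ b′ → + 4 * (a′ * b′) ≡ (+ 2 * a′) * (+ 2 * b′)
    scale = solve-∀
    identity : ∀ R Q a b s e₁ e₂ →
      (R * b * e₂ - a * e₁) * (Q * a * e₂ - b * e₁) ≡
      ((R * b * b + + 2 * s) * - e₁ + (R * Q) * (a * b) * e₂) * e₂ +
      ((R * b * b + + 2 * s) * e₂ + (a * b) * - e₁) * - e₁ +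
      (- (e₁ * e₂)) * ((Q * a * a - R * b * b) - + 4 * s)
    identity = solve-∀
    scale′ : ∀ x′ y′ e₁ e₂ → (+ 2 * x′) * e₂ + (+ 2 * y′) * - e₁ ≡ + 2 * (x′ * e₂ + y′ * - e₁)
    scale′ = solve-∀
    scale″ : ∀ y″ → + 2 * (+ 2 * y″) ≡ + 4 * y″
    scale″ = solve-∀

  descent-step : ∀ {a b s} → IsSign s → Solves a b s → 0ℤ < a * b →
    Σ ℤ λ a′ → Σ ℤ λ b′ → Solves a′ b′ (- s) × 0ℤ ≤ a′ * b′ × a′ * b′ < a * b
  descent-step {a} {b} {s} s-sign H 0<ab =
    let ((x′ , y′) , η/ε) = divide-by-ε {x , y} {1ℤ} η-norm
        (0<x′ , 0<y′) = quotient-of-norm-1 {x} {y} {x′} {y′} 0<x 0<ab η-norm η/ε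
        ν-norm = quotient-norm {x , y} {x′ , y′} {1ℤ} η-norm η/ε
        ((x″ , y″) , ν/ε) = divide-by-ε {x′ , y′} { -1ℤ} ν-norm
        (a′ , b′ , a-eq , b-eq , H′) = next-solution {a} {b} {s} H
        a′b′≡y″ = next-product {a} {b} {s} {a′} {b′} {x′} {y′} {x″} {y″} H a-eq b-eq η/ε ν/ε
    in a′ , b′ , H′ ,
       subst (0ℤ ≤_) (sym a′b′≡y″) (quotient-of-norm-−1 {x′} {y′} {x″} {y″} 0<x′ 0<y′ ν-norm ν/ε) ,
       subst (_< a * b) (sym a′b′≡y″)
         (<-trans (quotient-y<y {x′} {y′} { -1ℤ} {x″} {y″} (inj₂ refl) 0<x′ 0<y′ ν-norm ν/ε)
                  (quotient-y<y {x} {y} {1ℤ} {x′} {y′} (inj₁ refl) 0<x 0<ab η-norm η/ε))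
    where
    x y : ℤ
    x = R * b * b + + 2 * s
    y = a * b
    η-norm : NormIs (R * Q) (x , y) 1ℤ
    η-norm = square-norm s-sign H
    b≢0 : b ≢ 0ℤ
    b≢0 refl = <⇒≢ 0<ab (sym (*-zeroʳ a))
    -2≤2s : ∀ {s} → IsSign s → -[1+ 1 ] ≤ + 2 * s
    -2≤2s (inj₁ refl) = -≤+
    -2≤2s (inj₂ refl) = ≤-refl
    0<x : 0ℤ < x
    0<x = <-≤-trans (toWitness {a? = 0ℤ <? + 3} _) (+-mono-≤ (≤-trans 5≤R (≤-*-square 0≤R b≢0)) (-2≤2s s-sign))

  descent : ∀ n {a b s} → IsSign s → Solves a b s → 0ℤ ≤ a * b → a * b < + n → ⊥
  descent ℕ.zero _ _ 0≤ab ab<0 = <⇒≱ ab<0 0≤ab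
  descent (ℕ.suc n) {a} {b} s-sign H 0≤ab ab<1+n =
    let (a′ , b′ , H′ , 0≤a′b′ , a′b′<ab) = descent-step s-sign H 0<ab
    in descent n {a′} {b′} (sign-neg s-sign) H′ 0≤a′b′ (<-≤-trans a′b′<ab (i<j⇒i≤pred[j] ab<1+n))
    where
    0<ab : 0ℤ < a * b
    0<ab = ≤∧≢⇒< 0≤ab (solution-factors-nonzero s-sign H ∘ sym)

  no-solution : ∀ {a b s} → IsSign s → ¬ Solves a b s
  no-solution {a} {b} {s} s-sign H with 0ℤ ≤? a * b
  ... | yes 0≤ab = descent (ℕ.suc ∣ a * b ∣) s-sign H 0≤ab (i<1+∣i∣ 0≤ab)
  ... | no 0≰ab = descent (ℕ.suc ∣ a * - b ∣) s-sign H⁻ 0≤a[-b] (i<1+∣i∣ 0≤a[-b])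
    where
    identity : ∀ Q R a b → Q * a * a - R * - b * - b ≡ Q * a * a - R * b * b
    identity = solve-∀
    H⁻ : Solves a (- b) s
    H⁻ = trans (identity Q R a b) H
    0≤a[-b] : 0ℤ ≤ a * - b
    0≤a[-b] = subst (0ℤ ≤_) (neg-distribʳ-* a b) (neg-mono-≤ (<⇒≤ (≰⇒> 0≰ab)))

module PrincipalPrimeAbove {q r : ℕ.ℕ} (q-prime : Prime q) (q∤r : ¬ q ℕ.∣ r) where
  open IntegerFacts
  open NormEquation (+ r) (+ q)
  open RingOfIntegers (+ r ℤ.* + q)
  open import Data.Integer
  open import Data.Integer.Properties
  open import Data.Integer.Tactic.RingSolver using (solve-∀)
  import Data.Integer.Divisibility.Signed as Signed
  open import Data.Nat.Coprimality using (Coprime; coprime-factors)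
  open import Data.Nat.Primality using (prime⇒nonZero)
  open import Data.Product using (proj₁; proj₂)
  open import Relation.Binary.PropositionalEquality using (module ≡-Reasoning)

  R Q d : ℤ
  R = + r
  Q = + q
  d = R * Q

  instance
    Q≢0 : NonZero Q
    Q≢0 = prime⇒nonZero q-prime

  q-coprime-r : Coprime q r
  q-coprime-r (i∣q , i∣r) with prime⇒irreducible q-prime i∣q
  ... | inj₁ i≡1 = i≡1
  ... | inj₂ refl = contradiction i∣r q∤r

  divisor-of-q²-and-rq : ∀ {n} → n ℕ.∣ q ℕ.* q → n ℕ.∣ r ℕ.* q → n ≡ 1 ⊎ n ≡ q
  divisor-of-q²-and-rq n∣q² n∣rq = prime⇒irreducible q-prime (coprime-factors q-coprime-r (n∣q² , n∣rq))

  q̂ √d : Elem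
  q̂ = (+ (2 ℕ.* q) , + 0)
  √d = (+ 0 , + 2)

  q̂-norm : NormIs d q̂ (Q * Q)
  q̂-norm = trans (cong (λ t → t * t - d * + 0 * + 0) (pos-* 2 q)) (identity Q d)
    where
    identity : ∀ Q d → (+ 2 * Q) * (+ 2 * Q) - d * + 0 * + 0 ≡ + 4 * (Q * Q)
    identity = solve-∀

  √d-norm : NormIs d √d (- d)
  √d-norm = identity d
    where
    identity : ∀ d → + 0 * + 0 - d * + 2 * + 2 ≡ + 4 * - d
    identity = solve-∀

  √d∈P : ∀ {P} → IsPrimeIdeal d P → LiesAbove q P → P √d
  √d∈P {P} P-prime q̂∈P = [ id , id ]′ (prime √d √d d̂ (NormIs⇒IsInt {√d} √d-norm) (NormIs⇒IsInt {√d} √d-norm) √d² d̂∈P)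
    where
    open IsPrimeIdeal P-prime
    open IsIdeal ideal
    d̂ r̂ : Elem
    d̂ = (+ 2 * d , + 0)
    r̂ = (+ 2 * R , + 0)
    r̂-norm-identity : ∀ R d → (+ 2 * R) * (+ 2 * R) - d * + 0 * + 0 ≡ + 4 * (R * R)
    r̂-norm-identity = solve-∀
    re-identity : ∀ R Q → (+ 2 * Q) * (+ 2 * R) + (R * Q) * + 0 * + 0 ≡ + 2 * (+ 2 * (R * Q))
    re-identity = solve-∀
    im-identity : ∀ t R → t * + 0 + + 0 * (+ 2 * R) ≡ + 2 * + 0
    im-identity = solve-∀
    q̂r̂≡d̂ : MulIs d q̂ r̂ d̂
    q̂r̂≡d̂ = trans (cong (λ t → t * (+ 2 * R) + d * + 0 * + 0) (pos-* 2 q)) (re-identity R Q) ,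
            im-identity (+ (2 ℕ.* q)) R
    d̂∈P : P d̂
    d̂∈P = *-cl q̂ r̂ d̂ q̂∈P (NormIs⇒IsInt {r̂} {R * R} (r̂-norm-identity R d)) q̂r̂≡d̂
    √d²-identity : ∀ d → + 0 * + 0 + d * + 2 * + 2 ≡ + 2 * (+ 2 * d)
    √d²-identity = solve-∀
    √d² : MulIs d √d √d d̂
    √d² = √d²-identity d , refl

  norm-±q⇒solution : ∀ {a₀ b σ} → NormIs d (a₀ , b) (σ * Q) → Σ ℤ λ a → Solves a b σ
  norm-±q⇒solution {a₀} {b} {σ} N = a , *-cancelˡ-≡ Q _ _ (begin
    Q * (Q * a * a - R * b * b)     ≡⟨ identity₁ Q R a b ⟩
    (a * Q) * (a * Q) - d * b * b   ≡⟨ cong (λ t → t * t - d * b * b) (sym a₀≡aQ) ⟩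
    a₀ * a₀ - d * b * b             ≡⟨ N ⟩
    + 4 * (σ * Q)                   ≡⟨ identity₂ σ Q ⟩
    Q * (+ 4 * σ)                   ∎)
    where
    open ≡-Reasoning
    identity₀ : ∀ a₀ b R Q σ →
      a₀ * a₀ ≡ (R * b * b + + 4 * σ) * Q + + 1 * ((a₀ * a₀ - (R * Q) * b * b) - + 4 * (σ * Q))
    identity₀ = solve-∀
    identity₁ : ∀ Q R a b → Q * (Q * a * a - R * b * b) ≡ (a * Q) * (a * Q) - (R * Q) * b * b
    identity₁ = solve-∀
    identity₂ : ∀ σ Q → + 4 * (σ * Q) ≡ Q * (+ 4 * σ)
    identity₂ = solve-∀
    Q∣a₀ : Q Signed.∣ a₀
    Q∣a₀ = Signed.∣ᵤ⇒∣ (prime∣square⇒∣ a₀ q-prime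
             (Signed.∣⇒∣ᵤ {Q} (Signed.divides (R * b * b + + 4 * σ) (≡-modulo₁ N (+ 1) (identity₀ a₀ b R Q σ)))))
    a : ℤ
    a = Signed.quotient Q∣a₀
    a₀≡aQ : a₀ ≡ a * Q
    a₀≡aQ = Signed._∣_.equality Q∣a₀

  principal⇒solution : ∀ {P} → IsPrimeIdeal d P → LiesAbove q P → IsPrincipal d P →
                       Σ ℤ λ a → Σ ℤ λ b → Σ ℤ λ s → IsSign s × Solves a b s
  principal⇒solution {P} P-prime q̂∈P ((a₀ , b₀) , α-int , generates) =
    from-norm (divisor-of-q²-and-rq ∣n∣∣q² ∣n∣∣rq)
    where
    open IsPrimeIdeal P-prime
    open IsIdeal ideal
    n : ℤ
    n = proj₁ (IsInt⇒norm {a₀ , b₀} α-int)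
    Nα : NormIs d (a₀ , b₀) n
    Nα = proj₂ (IsInt⇒norm {a₀ , b₀} α-int)
    ∣n∣∣q² : ∣ n ∣ ℕ.∣ q ℕ.* q
    ∣n∣∣q² = subst (∣ n ∣ ℕ.∣_) (abs-* Q Q)
      (divides⇒norm∣ {a₀ , b₀} {q̂} (proj₁ (generates q̂ (⊆O q̂ q̂∈P)) q̂∈P) Nα q̂-norm)
    ∣n∣∣rq : ∣ n ∣ ℕ.∣ r ℕ.* q
    ∣n∣∣rq = subst (∣ n ∣ ℕ.∣_) (trans (∣-i∣≡∣i∣ d) (abs-* R Q))
      (divides⇒norm∣ {a₀ , b₀} {√d} (proj₁ (generates √d (⊆O √d √d∈P′)) √d∈P′) Nα √d-norm)
      where
      √d∈P′ : P √d
      √d∈P′ = √d∈P P-prime q̂∈P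
    one-norm-identity : ∀ d → + 2 * + 2 - d * + 0 * + 0 ≡ + 4 * 1ℤ
    one-norm-identity = solve-∀
    from-norm : ∣ n ∣ ≡ 1 ⊎ ∣ n ∣ ≡ q → Σ ℤ λ a → Σ ℤ λ b → Σ ℤ λ s → IsSign s × Solves a b s
    from-norm (inj₁ ∣n∣≡1) =
      let (σ , σ-sign , n≡σ) = ∣i∣≡n⇒i≡±n ∣n∣≡1
          α-unit = norm-sign⇒unit {a₀ , b₀} σ-sign (subst (NormIs d (a₀ , b₀)) (trans n≡σ (*-identityʳ σ)) Nα)
      in ⊥-elim (proper (proj₂ (generates one (NormIs⇒IsInt {one} {1ℤ} (one-norm-identity d))) (proj₂ α-unit)))
    from-norm (inj₂ ∣n∣≡q) =
      let (σ , σ-sign , n≡σQ) = ∣i∣≡n⇒i≡±n ∣n∣≡q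
          (a , H) = norm-±q⇒solution {a₀} {b₀} {σ} (subst (NormIs d (a₀ , b₀)) n≡σQ Nα)
      in a , b₀ , σ , σ-sign , H

NonPrincipalAbove : ℕ.ℕ → ℤ → Set₁
NonPrincipalAbove q d =
  Σ Elem (λ ε → IsFundamentalUnit d ε × NormIs d ε (ℤ.- (+ 1))) →
  (P : Elem → Set) → IsPrimeIdeal d P → LiesAbove q P → ¬ IsPrincipal d P

prime-above-not-principal : ∀ {q r} → Prime q → ¬ q ℕ.∣ r → 5 ℕ.≤ q → 5 ℕ.≤ r →
                            NonPrincipalAbove q (+ (r ℕ.* q))
prime-above-not-principal {q} {r} q-prime q∤r 5≤q 5≤r =
  subst (NonPrincipalAbove q) (sym (pos-* r q))
    λ ((e₁ , e₂) , ε-fundamental , Nε) P P-prime q∈P P-principal →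
      let (a , b , s , s-sign , H) = PrincipalPrimeAbove.principal⇒solution q-prime q∤r P-prime q∈P P-principal
      in Descent.no-solution (ℤ.+≤+ 5≤r) (ℤ.+≤+ 5≤q) ε-fundamental Nε s-sign H

%8≡5⇒5≤ : ∀ {p} → p ℕ.% 8 ≡ 5 → 5 ℕ.≤ p
%8≡5⇒5≤ {p} p≡5 = subst (ℕ._≤ p) p≡5 (m%n≤m p 8)

prime∧%8≡1⇒5≤ : ∀ {q} → Prime q → q ℕ.% 8 ≡ 1 → 5 ℕ.≤ q
prime∧%8≡1⇒5≤ {0} _ ()
prime∧%8≡1⇒5≤ {1} q-prime _ = ⊥-elim (¬prime[1] q-prime)
prime∧%8≡1⇒5≤ {2} _ ()
prime∧%8≡1⇒5≤ {3} _ ()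
prime∧%8≡1⇒5≤ {4} _ ()
prime∧%8≡1⇒5≤ {ℕ.suc (ℕ.suc (ℕ.suc (ℕ.suc (ℕ.suc k))))} _ _ =
  ℕ.s≤s (ℕ.s≤s (ℕ.s≤s (ℕ.s≤s (ℕ.s≤s ℕ.z≤n))))

prime∣prime⇒≡ : ∀ {p q} → Prime p → Prime q → q ℕ.∣ p → q ≡ p
prime∣prime⇒≡ p-prime q-prime q∣p =
  [ (λ q≡1 → ⊥-elim (¬prime[1] (subst Prime q≡1 q-prime))) , id ]′ (prime⇒irreducible p-prime q∣p)

open import Data.Nat using (ℕ; _%_; _∸_; _/_; _*_)
open import Data.Integer using (ℤ; +_; -_; _^_)

mainTheorem7 : (p q : ℕ) → Prime p → Prime q → p % 8 ≡ 5 → q % 8 ≡ 1 →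
    ((s : ℤ) → QuarticSymbol q (+ 2) s → s ≢ (- (+ 1)) ^ ((q ∸ 1) / 8)) →
    ((Σ Elem (λ ε → IsFundamentalUnit (+ (p * q)) ε × NormIs (+ (p * q)) ε (- (+ 1)))) →
      (P : Elem → Set) → IsPrimeIdeal (+ (p * q)) P → LiesAbove q P →
      ¬ IsPrincipal (+ (p * q)) P)
    ×
    ((Σ Elem (λ ε → IsFundamentalUnit (+ (2 * (p * q))) ε × NormIs (+ (2 * (p * q))) ε (- (+ 1)))) →
      (P : Elem → Set) → IsPrimeIdeal (+ (2 * (p * q))) P → LiesAbove q P →
      ¬ IsPrincipal (+ (2 * (p * q))) P)
mainTheorem7 p q p-prime q-prime p≡5 q≡1 _ =
  prime-above-not-principal q-prime q∤p 5≤q (%8≡5⇒5≤ p≡5) ,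
  subst (NonPrincipalAbove q) (cong +_ (*-assoc 2 p q))
    (prime-above-not-principal q-prime q∤2p 5≤q (≤-trans (%8≡5⇒5≤ p≡5) (m≤n*m p 2)))
  where
  open import Data.Nat.Properties using (*-assoc; ≤-trans; m≤n*m)
  5≤q : 5 ℕ.≤ q
  5≤q = prime∧%8≡1⇒5≤ q-prime q≡1
  q≢p : q ≢ p
  q≢p q≡p = contradiction (trans (sym q≡1) (trans (cong (_% 8) q≡p) p≡5)) λ ()
  q≢2 : q ≢ 2
  q≢2 q≡2 = contradiction (trans (sym q≡1) (cong (_% 8) q≡2)) λ ()
  q∤p : ¬ q ℕ.∣ p
  q∤p = q≢p ∘ prime∣prime⇒≡ p-prime q-prime
  q∤2p : ¬ q ℕ.∣ 2 * p
  q∤2p q∣2p = [ q≢2 ∘ prime∣prime⇒≡ prime[2] q-prime , q∤p ]′ (euclidsLemma 2 p q-prime q∣2p)
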